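{- Let $G$ be a plane graph, $n$ even, and $a_1,\ldots,a_n$ distinct vertices appearing in this cyclic order on a face of $G$; let $A=\{a_1,\ldots,a_n\}=A_K\cup A_H$ be a partition into disjoint subsets, and $H=G-A_K$. Suppose $H$ has exactly one perfect matching $M_H$. For $1\le i<j\le n$ define $H_{ij}$ as: the subgraph induced by $V(H)\cup\{a_i,a_j\}$ if $a_i,a_j\in A_K$; induced by $(V(H)\setminus\{a_j\})\cup\{a_i\}$ if $a_i\in A_K,a_j\in A_H$; induced by $(V(H)\setminus\{a_i\})\cup\{a_j\}$ if $a_i\in A_H,a_j\in A_K$; and $H-a_i-a_j$ if $a_i,a_j\in A_H$. Then for each $i<j$, the number of $M_H$-alternating paths from $a_i$ to $a_j$ equals $M(H_{ij})$.
   Context: $M(\Gamma)$ is the number of perfect matchings of $\Gamma$; $G-S$ is the subgraph induced by the vertices not in $S$. An $M_H$-alternating path from $a_i$ to $a_j$ is a path in $G$ with endpoints $a_i$ and $a_j$ in which every other edge belongs to $M_H$ (edges alternate between being in and not in $M_H$), and such that if $a_i\in A_H$ (respectively $a_j\in A_H$) then the path contains the edge of $M_H$ incident with $a_i$ (respectively $a_j$). -}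

module Defs where

open import Data.Bool using (Bool; true; false; _∧_; _∨_; not; _xor_; if_then_else_)
open import Data.Nat using (ℕ; zero; suc)
open import Data.Fin using (Fin; _≟_)
open import Data.List using (List; []; _∷_; map; concatMap; allFin; upTo; reverse; length)
open import Data.Vec using (Vec; lookup; toList)
import Data.Vec as Vec
open import Relation.Nullary.Decidable using (⌊_⌋)
open import Relation.Binary.PropositionalEquality using (_≡_)

record Graph (N : ℕ) : Set where
  field
    adj    : Fin N → Fin N → Bool
    sym    : ∀ u v → adj u v ≡ adj v u
    irrefl : ∀ v → adj v v ≡ false
open Graph public

VSet : ℕ → Set
VSet N = Fin N → Bool

_==_ : ∀ {N} → Fin N → Fin N → Bool
u == v = ⌊ u ≟ v ⌋

allᵇ : ∀ {A : Set} → (A → Bool) → List A → Bool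
allᵇ p [] = true
allᵇ p (x ∷ xs) = p x ∧ allᵇ p xs

anyᵇ : ∀ {A : Set} → (A → Bool) → List A → Bool
anyᵇ p [] = false
anyᵇ p (x ∷ xs) = p x ∨ anyᵇ p xs

countᵇ : ∀ {A : Set} → (A → Bool) → List A → ℕ
countᵇ p [] = zero
countᵇ p (x ∷ xs) = if p x then suc (countᵇ p xs) else countᵇ p xs

allVecs : ∀ {N} (k : ℕ) → List (Vec (Fin N) k)
allVecs zero = Vec.[] ∷ []
allVecs {N} (suc k) = concatMap (λ x → map (x Vec.∷_) (allVecs k)) (allFin N)

allListsUpTo : (N : ℕ) → List (List (Fin N))
allListsUpTo N = concatMap (λ k → map toList (allVecs {N} k)) (upTo (suc N))

-- A perfect matching of the induced subgraph G[S], encoded by its partner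
-- function m (as a vector indexed by vertices): every v ∈ S is matched to
-- m v ∈ S, adjacent to v, with m (m v) = v; vertices outside S are fixed
-- (normalisation, so matchings correspond bijectively to such vectors).
isPM : ∀ {N} → Graph N → VSet N → Vec (Fin N) N → Bool
isPM {N} G S m = allᵇ ok (allFin N)
  where
  ok : Fin N → Bool
  ok v = if S v
         then (S (lookup m v) ∧ adj G v (lookup m v) ∧ (lookup m (lookup m v) == v))
         else (lookup m v == v)

M : ∀ {N} → Graph N → VSet N → ℕ
M {N} G S = countᵇ (isPM G S) (allVecs N)

-- Setting: terminals a : Fin n → Fin N, partition A = A_K ∪ A_H given by
-- isK (isK k = true  iff  a_k ∈ A_K).
inAK : ∀ {N n} → (Fin n → Fin N) → (Fin n → Bool) → Fin N → Bool
inAK {n = n} a isK v = anyᵇ (λ k → isK k ∧ (a k == v)) (allFin n)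

VH : ∀ {N n} → (Fin n → Fin N) → (Fin n → Bool) → VSet N
VH a isK v = not (inAK a isK v)

VHij : ∀ {N n} → (Fin n → Fin N) → (Fin n → Bool) → Fin n → Fin n → VSet N
VHij a isK i j v with isK i | isK j
... | true  | true  = VH a isK v ∨ (v == a i) ∨ (v == a j)
... | true  | false = (VH a isK v ∧ not (v == a j)) ∨ (v == a i)
... | false | true  = (VH a isK v ∧ not (v == a i)) ∨ (v == a j)
... | false | false = VH a isK v ∧ not (v == a i) ∧ not (v == a j)

adjChain : ∀ {N} → Graph N → List (Fin N) → Bool
adjChain G (u ∷ v ∷ rest) = adj G u v ∧ adjChain G (v ∷ rest)
adjChain G _ = true

allDistinct : ∀ {N} → List (Fin N) → Bool
allDistinct [] = true
allDistinct (x ∷ xs) = not (anyᵇ (x ==_) xs) ∧ allDistinct xs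

startsWith : ∀ {N} → Fin N → List (Fin N) → Bool
startsWith a (x ∷ _) = x == a
startsWith a [] = false

atLeastTwo : ∀ {A : Set} → List A → Bool
atLeastTwo (_ ∷ _ ∷ _) = true
atLeastTwo _ = false

module _ {N : ℕ} (mH : Vec (Fin N) N) where
  inM : Fin N → Fin N → Bool
  inM u v = (lookup mH u == v) ∨ (lookup mH v == u)

  alternating : List (Fin N) → Bool
  alternating (u ∷ v ∷ w ∷ rest) = (inM u v xor inM v w) ∧ alternating (v ∷ w ∷ rest)
  alternating _ = true

  firstEdgeInM : List (Fin N) → Bool
  firstEdgeInM (u ∷ v ∷ _) = inM u v
  firstEdgeInM _ = false

isAltPath : ∀ {N n} → Graph N → (Fin n → Fin N) → (Fin n → Bool) →
            Vec (Fin N) N → Fin n → Fin n → List (Fin N) → Bool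
isAltPath G a isK mH i j p =
  atLeastTwo p ∧ allDistinct p ∧ adjChain G p
  ∧ startsWith (a i) p ∧ startsWith (a j) (reverse p)
  ∧ alternating mH p
  -- if a_i ∈ A_H the path contains the M_H-edge at a_i (necessarily its first edge)
  ∧ (isK i ∨ firstEdgeInM mH p)
  -- if a_j ∈ A_H the path contains the M_H-edge at a_j (necessarily its last edge)
  ∧ (isK j ∨ firstEdgeInM mH (reverse p))

-- number of M_H-alternating paths from a_i to a_j (paths are simple, so have ≤ N vertices)
numAltPaths : ∀ {N n} → Graph N → (Fin n → Fin N) → (Fin n → Bool) →
              Vec (Fin N) N → Fin n → Fin n → ℕ
numAltPaths {N} G a isK mH i j = countᵇ (isAltPath G a isK mH i j) (allListsUpTo N)

{-# OPTIONS --safe #-}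
module Submission where

-- Write M_H as an involution h, and a perfect matching of H_ij as an involution m. As V(H_ij)
-- differs from V(H) exactly in a_i and a_j, the walk leaving a_i alternately along h and m
-- (first along h iff a_i ∈ V(H)) can only stall at a_j, and it cannot revisit a vertex, being a
-- zigzag of two involutions that starts at a fixed point of one of them; so it traces an
-- M_H-alternating path from a_i to a_j. Conversely, trading the M_H-edges of such a path for its
-- other edges turns h into a perfect matching of H_ij. The two constructions are mutually inverse
-- because m agrees with h off the path: h on the path spliced with m off it is a perfect matching
-- of H, hence equal to M_H.

module MatchingsAndAlternatingPaths where

  open import Defs hiding (sym)
  open import Data.Bool using (Bool; true; false; _∧_; _∨_; not; _xor_; if_then_else_)
  open import Data.Bool.Properties using (not-involutive; not-injective; not-¬; ¬-not; xor-inverseʳ; ∨-inverseˡ; ∨-zeroʳ; ∨-identityʳ; ∧-zeroʳ; ∧-identityʳ; ⇔→≡; ∨-comm; T-≡)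
  import Data.Bool
  open import Data.Nat using (ℕ; zero; suc; _+_; _∸_; _≤_; _<_; z≤n; s≤s; _<ᵇ_)
  open import Data.Nat.Properties hiding (_≟_)
  open import Data.Fin using (Fin; toℕ; _≟_)
  import Data.Fin.Properties as Fin
  open import Data.Maybe using (Maybe; just; nothing; maybe′)
  import Data.Maybe as Maybe
  open import Data.Vec using (Vec; lookup; tabulate; toList; fromList)
  import Data.Vec as Vec
  import Data.Vec.Properties as Vec
  open import Data.List using (List; []; _∷_; length; map; filter; allFin; upTo; reverse; applyUpTo; applyDownFrom)
  import Data.List.Properties as List
  open import Data.List.Membership.Propositional using (_∈_)
  open import Data.List.Membership.Propositional.Properties
  open import Data.List.Membership.Propositional.Properties.WithK using (unique∧set⇒bag)
  open import Data.List.Relation.Unary.Any using (here; there)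
  import Data.List.Relation.Unary.Any as Any
  import Data.List.Relation.Unary.All as All
  import Data.List.Relation.Unary.All.Properties as All
  import Data.List.Relation.Unary.AllPairs as AllPairs
  import Data.List.Relation.Unary.AllPairs.Properties as AllPairs
  open import Data.List.Relation.Unary.Unique.Propositional using (Unique)
  import Data.List.Relation.Unary.Unique.Propositional.Properties as Unique
  open import Data.List.Relation.Binary.BagAndSetEquality using (∼bag⇒↭)
  open import Data.List.Relation.Binary.Permutation.Propositional.Properties using (↭-length)
  open import Relation.Binary.Definitions using (tri<; tri≈; tri>)
  open import Data.Product using (∃-syntax; _×_; _,_; proj₁; proj₂)
  open import Data.Sum using (_⊎_; inj₁; inj₂)
  open import Data.Empty using (⊥)
  open import Function using (_∘_; _⇔_; mk⇔; Equivalence)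
  open import Relation.Nullary using (Dec; yes; no; contradiction)
  open import Relation.Nullary.Decidable using (T?)
  open import Relation.Binary.PropositionalEquality

  ==-refl : ∀ {N} (u : Fin N) → (u == u) ≡ true
  ==-refl u with u ≟ u
  ... | yes _   = refl
  ... | no u≢u = contradiction refl u≢u

  ≢⇒==-false : ∀ {N} {u v : Fin N} → u ≢ v → (u == v) ≡ false
  ≢⇒==-false {u = u} {v} u≢v with u ≟ v
  ... | yes u≡v = contradiction u≡v u≢v
  ... | no _    = refl

  ==⇒≡ : ∀ {N} {u v : Fin N} → (u == v) ≡ true → u ≡ v
  ==⇒≡ {u = u} {v} u==v with u ≟ v
  ... | yes u≡v = u≡v

  ==-false⇒≢ : ∀ {N} {u v : Fin N} → (u == v) ≡ false → u ≢ v
  ==-false⇒≢ {u = u} u==v refl = contradiction (trans (sym u==v) (==-refl u)) λ ()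

  ∧-intro : ∀ {a b} → a ≡ true → b ≡ true → a ∧ b ≡ true
  ∧-intro refl refl = refl

  ∧-split : ∀ a {b} → a ∧ b ≡ true → a ≡ true × b ≡ true
  ∧-split true {true} _ = refl , refl

  ∧-split₇ : ∀ a b c d e f {g} → a ∧ b ∧ c ∧ d ∧ e ∧ f ∧ g ≡ true →
             a ≡ true × b ≡ true × c ≡ true × d ≡ true × e ≡ true × f ≡ true × g ≡ true
  ∧-split₇ true true true true true true {true} _ = refl , refl , refl , refl , refl , refl , refl

  xor≡true⇒≡not : ∀ {a b} → a xor b ≡ true → b ≡ not a
  xor≡true⇒≡not {false} {true} _ = refl
  xor≡true⇒≡not {true} {false} _ = refl

  allᵇ-∈ : ∀ {A : Set} (p : A → Bool) xs → allᵇ p xs ≡ true → ∀ {x} → x ∈ xs → p x ≡ true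
  allᵇ-∈ p (x ∷ xs) all-p (here refl) = proj₁ (∧-split (p x) all-p)
  allᵇ-∈ p (x ∷ xs) all-p (there x∈xs) = allᵇ-∈ p xs (proj₂ (∧-split (p x) all-p)) x∈xs

  allᵇ-universal : ∀ {A : Set} (p : A → Bool) → (∀ x → p x ≡ true) → ∀ xs → allᵇ p xs ≡ true
  allᵇ-universal p all-p [] = refl
  allᵇ-universal p all-p (x ∷ xs) rewrite all-p x = allᵇ-universal p all-p xs

  anyᵇ-∈ : ∀ {A : Set} (p : A → Bool) {xs x} → x ∈ xs → p x ≡ true → anyᵇ p xs ≡ true
  anyᵇ-∈ p {x ∷ _} (here refl) px rewrite px = refl
  anyᵇ-∈ p {y ∷ _} (there x∈xs) px rewrite anyᵇ-∈ p x∈xs px = ∨-zeroʳ (p y)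

  anyᵇ-witness : ∀ {A : Set} (p : A → Bool) xs → anyᵇ p xs ≡ true → ∃[ x ] p x ≡ true
  anyᵇ-witness p (x ∷ xs) any-p with p x in px
  ... | true  = x , px
  ... | false = anyᵇ-witness p xs any-p

  countᵇ≡length-filter : ∀ {A : Set} (p : A → Bool) xs → countᵇ p xs ≡ length (filter (T? ∘ p) xs)
  countᵇ≡length-filter p [] = refl
  countᵇ≡length-filter p (x ∷ xs) with p x
  ... | true  = cong suc (countᵇ≡length-filter p xs)
  ... | false = countᵇ≡length-filter p xs

  countᵇ-cong : ∀ {A : Set} {p q : A → Bool} → (∀ x → p x ≡ q x) → ∀ xs → countᵇ p xs ≡ countᵇ q xs
  countᵇ-cong p≗q [] = refl
  countᵇ-cong {q = q} p≗q (x ∷ xs) rewrite p≗q x =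
    cong (λ n → if q x then suc n else n) (countᵇ-cong p≗q xs)

  -- map f (filter p xs) and filter q ys are duplicate-free with the same members, hence permutations.
  countᵇ-bijection :
    ∀ {A B : Set} (p : A → Bool) (q : B → Bool) {xs : List A} {ys : List B} →
    Unique xs → Unique ys →
    (∀ x → p x ≡ true → x ∈ xs) → (∀ y → q y ≡ true → y ∈ ys) →
    (f : A → B) (g : B → A) →
    (∀ x → p x ≡ true → q (f x) ≡ true) → (∀ y → q y ≡ true → p (g y) ≡ true) →
    (∀ x → p x ≡ true → g (f x) ≡ x) → (∀ y → q y ≡ true → f (g y) ≡ y) →
    countᵇ p xs ≡ countᵇ q ys
  countᵇ-bijection {A} {B} p q {xs} {ys} xs! ys! xs-complete ys-complete f g f-pres g-pres gf fg = begin
    countᵇ p xs             ≡⟨ countᵇ≡length-filter p xs ⟩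
    length ps               ≡⟨ List.length-map f ps ⟨
    length (map f ps)       ≡⟨ ↭-length (∼bag⇒↭ (unique∧set⇒bag fps! qs! same-members)) ⟩
    length qs               ≡⟨ countᵇ≡length-filter q ys ⟨
    countᵇ q ys             ∎
    where
    open ≡-Reasoning
    ps : List A
    ps = filter (T? ∘ p) xs
    qs : List B
    qs = filter (T? ∘ q) ys
    p-of : ∀ {x} → x ∈ ps → p x ≡ true
    p-of x∈ps = Equivalence.to T-≡ (proj₂ (∈-filter⁻ (T? ∘ p) {xs = xs} x∈ps))
    gfps≡ps : map g (map f ps) ≡ ps
    gfps≡ps = trans (sym (List.map-∘ ps)) (List.map-id-local (All.tabulate (gf _ ∘ p-of)))
    fps! : Unique (map f ps)
    fps! = Unique.map⁻ (subst Unique (sym gfps≡ps) (Unique.filter⁺ (T? ∘ p) xs!))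
    qs! : Unique qs
    qs! = Unique.filter⁺ (T? ∘ q) ys!
    ∈qs : ∀ {y} → q y ≡ true → y ∈ qs
    ∈qs qy = ∈-filter⁺ (T? ∘ q) (ys-complete _ qy) (Equivalence.from T-≡ qy)
    same-members : ∀ {y} → (y ∈ map f ps) ⇔ (y ∈ qs)
    same-members = mk⇔ to from
      where
      to : ∀ {y} → y ∈ map f ps → y ∈ qs
      to y∈fps with x , x∈ps , refl ← ∈-map⁻ f y∈fps = ∈qs (f-pres _ (p-of x∈ps))
      from : ∀ {y} → y ∈ qs → y ∈ map f ps
      from {y} y∈qs = subst (_∈ map f ps) (fg y qy)
        (∈-map⁺ f (∈-filter⁺ (T? ∘ p) (xs-complete _ pgy) (Equivalence.from T-≡ pgy)))
        where
        qy : q y ≡ true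
        qy = Equivalence.to T-≡ (proj₂ (∈-filter⁻ (T? ∘ q) {xs = ys} y∈qs))
        pgy : p (g y) ≡ true
        pgy = g-pres y qy

  module _ {N : ℕ} where

    ∈-allVecs : ∀ {k} (v : Vec (Fin N) k) → v ∈ allVecs k
    ∈-allVecs Vec.[] = here refl
    ∈-allVecs (u Vec.∷ v) =
      ∈-concatMap⁺ _ (Any.map (λ { refl → ∈-map⁺ (u Vec.∷_) (∈-allVecs v) }) (∈-allFin u))

    allVecs-unique : ∀ k → Unique (allVecs {N} k)
    allVecs-unique zero = All.[] AllPairs.∷ AllPairs.[]
    allVecs-unique (suc k) =
      Unique.concat⁺
        (All.map⁺ (All.universal (λ _ → Unique.map⁺ Vec.∷-injectiveʳ (allVecs-unique k)) (allFin N)))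
        (AllPairs.map⁺ (AllPairs.map disjoint (Unique.allFin⁺ N)))
      where
      disjoint : ∀ {u w : Fin N} → u ≢ w → ∀ {v} →
                 v ∈ map (u Vec.∷_) (allVecs k) × v ∈ map (w Vec.∷_) (allVecs k) → ⊥
      disjoint u≢w (v∈u∷ , v∈w∷)
        with _ , _ , refl ← ∈-map⁻ _ v∈u∷ | _ , _ , eq ← ∈-map⁻ _ v∈w∷ = u≢w (Vec.∷-injectiveˡ eq)

    ∈-allListsUpTo : (P : List (Fin N)) → length P ≤ N → P ∈ allListsUpTo N
    ∈-allListsUpTo P |P|≤N =
      ∈-concatMap⁺ (λ k → map toList (allVecs {N} k)) (Any.map listed (∈-upTo⁺ (s≤s |P|≤N)))
      where
      listed : ∀ {k} → length P ≡ k → P ∈ map toList (allVecs {N} k)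
      listed refl = subst (_∈ map toList (allVecs (length P))) (Vec.toList∘fromList P)
                          (∈-map⁺ toList (∈-allVecs (fromList P)))

    allListsUpTo-unique : Unique (allListsUpTo N)
    allListsUpTo-unique =
      Unique.concat⁺
        (All.map⁺ (All.universal (λ k → Unique.map⁺ toList-injective (allVecs-unique k)) (upTo (suc N))))
        (AllPairs.map⁺ (AllPairs.map disjoint (Unique.upTo⁺ (suc N))))
      where
      toList-injective : ∀ {k} {v w : Vec (Fin N) k} → toList v ≡ toList w → v ≡ w
      toList-injective {v = Vec.[]} {Vec.[]} _ = refl
      toList-injective {v = _ Vec.∷ _} {_ Vec.∷ _} eq =
        cong₂ Vec._∷_ (List.∷-injectiveˡ eq) (toList-injective (List.∷-injectiveʳ eq))
      disjoint : ∀ {k l} → k ≢ l → ∀ {P} →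
                 P ∈ map toList (allVecs {N} k) × P ∈ map toList (allVecs {N} l) → ⊥
      disjoint k≢l (P∈k , P∈l) with v , _ , refl ← ∈-map⁻ _ P∈k | w , _ , eq ← ∈-map⁻ _ P∈l =
        k≢l (trans (sym (Vec.length-toList v)) (trans (cong length eq) (Vec.length-toList w)))

  record IsPerfectMatching {N} (G : Graph N) (X : VSet N) (m : Fin N → Fin N) : Set where
    field
      covers : ∀ v → X v ≡ true → X (m v) ≡ true × adj G v (m v) ≡ true × m (m v) ≡ v
      fixes  : ∀ v → X v ≡ false → m v ≡ v

    involutive : ∀ v → m (m v) ≡ v
    involutive v with X v in Xv
    ... | true  = proj₂ (proj₂ (covers v Xv))
    ... | false = trans (cong m (fixes v Xv)) (fixes v Xv)

    fixed⇒∉ : ∀ {v} → m v ≡ v → X v ≡ false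
    fixed⇒∉ {v} mv≡v with X v in Xv
    ... | false = refl
    ... | true  = contradiction
      (trans (sym (proj₁ (proj₂ (covers v Xv)))) (trans (cong (adj G v) mv≡v) (irrefl G v))) λ ()

    moved⇒∈ : ∀ {v} → m v ≢ v → X v ≡ true
    moved⇒∈ {v} mv≢v with X v in Xv
    ... | true  = refl
    ... | false = contradiction (fixes v Xv) mv≢v

    ∈⇒moved : ∀ {v} → X v ≡ true → m v ≢ v
    ∈⇒moved Xv mv≡v = contradiction (trans (sym Xv) (fixed⇒∉ mv≡v)) λ ()

    adjacent : ∀ {v} → m v ≢ v → adj G v (m v) ≡ true
    adjacent {v} mv≢v = proj₁ (proj₂ (covers v (moved⇒∈ mv≢v)))

    preserves : ∀ v → X (m v) ≡ X v
    preserves v with X v in Xv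
    ... | true  = proj₁ (covers v Xv)
    ... | false = trans (cong X (fixes v Xv)) Xv

  module _ {N} (G : Graph N) (X : VSet N) where

    isPM⇒IsPerfectMatching : ∀ m → isPM G X m ≡ true → IsPerfectMatching G X (lookup m)
    isPM⇒IsPerfectMatching m pm = record { covers = covers ; fixes = fixes }
      where
      ok : ∀ v → (if X v then X (lookup m v) ∧ adj G v (lookup m v) ∧ (lookup m (lookup m v) == v)
                         else (lookup m v == v)) ≡ true
      ok v = allᵇ-∈ _ (allFin N) pm (∈-allFin v)
      covers : ∀ v → X v ≡ true → X (lookup m v) ≡ true × adj G v (lookup m v) ≡ true × lookup m (lookup m v) ≡ v
      covers v Xv with ok v
      ... | ok-v rewrite Xv with ∧-split _ ok-v
      ... | X-mv , ok-v′ with ∧-split _ ok-v′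
      ... | adj-v , mmv = X-mv , adj-v , ==⇒≡ mmv
      fixes : ∀ v → X v ≡ false → lookup m v ≡ v
      fixes v Xv with ok v
      ... | ok-v rewrite Xv = ==⇒≡ ok-v

    IsPerfectMatching⇒isPM : ∀ {m} → IsPerfectMatching G X m → isPM G X (tabulate m) ≡ true
    IsPerfectMatching⇒isPM {m} pm = allᵇ-universal _ ok (allFin N)
      where
      open IsPerfectMatching pm
      ok : ∀ v → (if X v then X (lookup (tabulate m) v) ∧ adj G v (lookup (tabulate m) v)
                                  ∧ (lookup (tabulate m) (lookup (tabulate m) v) == v)
                         else (lookup (tabulate m) v == v)) ≡ true
      ok v rewrite Vec.lookup∘tabulate m v with X v in Xv
      ... | true rewrite Vec.lookup∘tabulate m (m v) with covers v Xv
      ... | X-mv , adj-v , mmv rewrite X-mv | adj-v | mmv = ==-refl v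
      ok v | false rewrite fixes v Xv = ==-refl v

  InjectiveBelow : ∀ {A : Set} → (ℕ → A) → ℕ → Set
  InjectiveBelow Z n = ∀ {s t} → s < t → t < n → Z s ≢ Z t

  InjectiveBelow-bound : ∀ {N} (Z : ℕ → Fin N) n → InjectiveBelow Z n → n ≤ N
  InjectiveBelow-bound {N} Z n injective with n ≤? N
  ... | yes n≤N = n≤N
  ... | no n≰N with i , j , i<j , eq ← Fin.pigeonhole (≰⇒> n≰N) (Z ∘ toℕ) =
    contradiction eq (injective i<j (Fin.toℕ<n j))

  alternate : Bool → ℕ → Bool
  alternate b zero    = b
  alternate b (suc k) = not (alternate b k)

  alternate-not : ∀ b k → alternate (not b) k ≡ alternate b (suc k)
  alternate-not b zero    = refl
  alternate-not b (suc k) = cong not (alternate-not b k)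

  zigzag : ∀ {A : Set} → (Bool → A → A) → Bool → A → ℕ → A
  zigzag step b x zero    = x
  zigzag step b x (suc k) = step (alternate b k) (zigzag step b x k)

  module _ {A : Set} (step : Bool → A → A) (step-involutive : ∀ b v → step b (step b v) ≡ v)
           (b : Bool) (x : A) where

    private
      walk : ℕ → A
      walk = zigzag step b x

    zigzag-back : ∀ k → step (alternate b k) (walk (suc k)) ≡ walk k
    zigzag-back k = step-involutive _ (walk k)

    -- A repetition walk s ≡ walk (suc t) is reflected to walk (suc s) ≡ walk t when the steps at s
    -- and t agree, and otherwise to walk (pred s) ≡ walk t; the latter ends at the fixed start x.
    module _ (x-fixed : step (not b) x ≡ x) (K : ℕ) (no-stall : ∀ s → s < K → walk (suc s) ≢ walk s) where

      zigzag-injective : InjectiveBelow walk (suc K)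
      zigzag-injective {s} {suc t} (s≤s s≤t) t<K walk-s≡walk-t with alternate b s Data.Bool.≟ alternate b t
      ... | yes same-step with m≤n⇒m<n∨m≡n s≤t
      ...   | inj₂ refl = no-stall s (≤-pred t<K) (sym walk-s≡walk-t)
      ...   | inj₁ s<t with m≤n⇒m<n∨m≡n s<t
      ...     | inj₂ refl = contradiction same-step (not-¬ refl)
      ...     | inj₁ s+1<t = zigzag-injective s+1<t (m<n⇒m<1+n (≤-pred t<K)) (begin
        walk (suc s)                         ≡⟨ cong (step (alternate b s)) walk-s≡walk-t ⟩
        step (alternate b s) (walk (suc t))  ≡⟨ cong (λ c → step c (walk (suc t))) same-step ⟩
        step (alternate b t) (walk (suc t))  ≡⟨ zigzag-back t ⟩
        walk t                               ∎)
        where open ≡-Reasoning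
      zigzag-injective {zero} {suc zero} _ _ _ | no other-step = other-step refl
      zigzag-injective {zero} {suc t@(suc _)} _ t<K walk-0≡walk-t | no other-step =
        zigzag-injective (s≤s z≤n) (m<n⇒m<1+n (≤-pred t<K)) (begin
          x                                    ≡⟨ x-fixed ⟨
          step (not b) x                       ≡⟨ cong (λ c → step c x) (sym (¬-not {alternate b t} {b} (other-step ∘ sym))) ⟩
          step (alternate b t) x               ≡⟨ cong (step (alternate b t)) walk-0≡walk-t ⟩
          step (alternate b t) (walk (suc t))  ≡⟨ zigzag-back t ⟩
          walk t                               ∎)
        where open ≡-Reasoning
      zigzag-injective {suc s} {suc t} (s≤s s<t) t<K walk-s≡walk-t | no other-step =
        zigzag-injective s<t (m<n⇒m<1+n (≤-pred t<K)) (begin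
          walk s                                ≡⟨ zigzag-back s ⟨
          step (alternate b s) (walk (suc s))  ≡⟨ cong (λ c → step c (walk (suc s))) (not-injective (¬-not other-step)) ⟩
          step (alternate b t) (walk (suc s))  ≡⟨ cong (step (alternate b t)) walk-s≡walk-t ⟩
          step (alternate b t) (walk (suc t))  ≡⟨ zigzag-back t ⟩
          walk t                                ∎)
        where open ≡-Reasoning

  at : ∀ {A : Set} → A → List A → ℕ → A
  at d []       k       = d
  at d (a ∷ as) zero    = a
  at d (a ∷ as) (suc k) = at d as k

  applyUpTo-at : ∀ {A : Set} (d : A) P → applyUpTo (at d P) (length P) ≡ P
  applyUpTo-at d []       = refl
  applyUpTo-at d (a ∷ as) = cong (a ∷_) (applyUpTo-at d as)

  at-applyUpTo : ∀ {A : Set} (d : A) Z {n k} → k < n → at d (applyUpTo Z n) k ≡ Z k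
  at-applyUpTo d Z {suc n} {zero}  _         = refl
  at-applyUpTo d Z {suc n} {suc k} (s≤s k<n) = at-applyUpTo d (Z ∘ suc) k<n

  applyUpTo-cong : ∀ {A : Set} {f g : ℕ → A} n → (∀ {k} → k < n → f k ≡ g k) → applyUpTo f n ≡ applyUpTo g n
  applyUpTo-cong zero    f≗g = refl
  applyUpTo-cong (suc n) f≗g = cong₂ _∷_ (f≗g (s≤s z≤n)) (applyUpTo-cong n (f≗g ∘ s≤s))

  module _ {N : ℕ} where

    anyᵇ-==-false⇔All-≢ : ∀ (u : Fin N) xs → anyᵇ (u ==_) xs ≡ false ⇔ All.All (u ≢_) xs
    anyᵇ-==-false⇔All-≢ u xs = mk⇔ (to xs) (from xs)
      where
      to : ∀ xs → anyᵇ (u ==_) xs ≡ false → All.All (u ≢_) xs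
      to []       _ = All.[]
      to (v ∷ xs) none with u == v in u==v
      ... | false = ==-false⇒≢ u==v All.∷ to xs none
      from : ∀ xs → All.All (u ≢_) xs → anyᵇ (u ==_) xs ≡ false
      from []       _              = refl
      from (v ∷ xs) (u≢v All.∷ u≢xs) rewrite ≢⇒==-false u≢v = from xs u≢xs

    allDistinct⇔Unique : (P : List (Fin N)) → allDistinct P ≡ true ⇔ Unique P
    allDistinct⇔Unique P = mk⇔ (to P) (from P)
      where
      to : ∀ P → allDistinct P ≡ true → Unique P
      to []      _        = AllPairs.[]
      to (u ∷ P) distinct with anyᵇ (u ==_) P in u∈P
      ... | false = Equivalence.to (anyᵇ-==-false⇔All-≢ u P) u∈P AllPairs.∷ to P distinct
      from : ∀ P → Unique P → allDistinct P ≡ true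
      from []      _                   = refl
      from (u ∷ P) (u∉P AllPairs.∷ P!) rewrite Equivalence.from (anyᵇ-==-false⇔All-≢ u P) u∉P = from P P!

    Unique-applyUpTo⁻ : ∀ (Z : ℕ → Fin N) n → Unique (applyUpTo Z n) → InjectiveBelow Z n
    Unique-applyUpTo⁻ Z (suc n) (Z0∉ AllPairs.∷ _) {zero}  {suc t} _         (s≤s t<n) =
      All.applyUpTo⁻ (Z ∘ suc) n Z0∉ t<n
    Unique-applyUpTo⁻ Z (suc n) (_ AllPairs.∷ Z!)  {suc s} {suc t} (s≤s s<t) (s≤s t<n) =
      Unique-applyUpTo⁻ (Z ∘ suc) n Z! s<t t<n

    adjChain-applyUpTo : ∀ (G : Graph N) Z n →
      adjChain G (applyUpTo Z (suc n)) ≡ true ⇔ (∀ {k} → k < n → adj G (Z k) (Z (suc k)) ≡ true)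
    adjChain-applyUpTo G Z n = mk⇔ (to Z n) (from Z n)
      where
      to : ∀ Z n → adjChain G (applyUpTo Z (suc n)) ≡ true → ∀ {k} → k < n → adj G (Z k) (Z (suc k)) ≡ true
      to Z (suc n) chain {zero}  _         = proj₁ (∧-split _ chain)
      to Z (suc n) chain {suc k} (s≤s k<n) = to (Z ∘ suc) n (proj₂ (∧-split (adj G (Z 0) (Z 1)) chain)) k<n
      from : ∀ Z n → (∀ {k} → k < n → adj G (Z k) (Z (suc k)) ≡ true) → adjChain G (applyUpTo Z (suc n)) ≡ true
      from Z zero    _     = refl
      from Z (suc n) edges rewrite edges {0} (s≤s z≤n) = from (Z ∘ suc) n (edges ∘ s≤s)

  module _ {N : ℕ} (mH : Vec (Fin N) N) where

    edgeInM : (ℕ → Fin N) → ℕ → Bool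
    edgeInM Z k = inM mH (Z k) (Z (suc k))

    alternating-applyUpTo : ∀ Z n →
      alternating mH (applyUpTo Z (suc (suc n))) ≡ true ⇔
      (∀ {k} → k ≤ n → edgeInM Z k ≡ alternate (edgeInM Z 0) k)
    alternating-applyUpTo Z n = mk⇔ (to Z n) (from Z n)
      where
      to : ∀ Z n → alternating mH (applyUpTo Z (suc (suc n))) ≡ true →
           ∀ {k} → k ≤ n → edgeInM Z k ≡ alternate (edgeInM Z 0) k
      to Z n       alt {zero}  _         = refl
      to Z (suc n) alt {suc k} (s≤s k≤n) with ∧-split _ alt
      ... | e₀-xor-e₁ , alt′ = begin
        edgeInM Z (suc k)                ≡⟨ to (Z ∘ suc) n alt′ k≤n ⟩
        alternate (edgeInM Z 1) k        ≡⟨ cong (λ c → alternate c k) (xor≡true⇒≡not e₀-xor-e₁) ⟩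
        alternate (not (edgeInM Z 0)) k  ≡⟨ alternate-not (edgeInM Z 0) k ⟩
        alternate (edgeInM Z 0) (suc k)  ∎
        where open ≡-Reasoning
      from : ∀ Z n → (∀ {k} → k ≤ n → edgeInM Z k ≡ alternate (edgeInM Z 0) k) →
             alternating mH (applyUpTo Z (suc (suc n))) ≡ true
      from Z zero    _   = refl
      from Z (suc n) alt rewrite alt {1} (s≤s z≤n) =
        cong₂ _∧_ (xor-inverseʳ (edgeInM Z 0)) (from (Z ∘ suc) n shifted)
        where
        shifted : ∀ {k} → k ≤ n → edgeInM Z (suc k) ≡ alternate (edgeInM Z 1) k
        shifted {k} k≤n rewrite alt {1} (s≤s z≤n) =
          trans (alt (s≤s k≤n)) (sym (alternate-not (edgeInM Z 0) k))

  module _ {N : ℕ} where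

    indexOf : (ℕ → Fin N) → ℕ → Fin N → Maybe ℕ
    indexOf Z zero    v = nothing
    indexOf Z (suc n) v = if Z 0 == v then just 0 else Maybe.map suc (indexOf (Z ∘ suc) n v)

    indexOf-just : ∀ Z n {v k} → indexOf Z n v ≡ just k → k < n × Z k ≡ v
    indexOf-just Z (suc n) {v} found with Z 0 == v in Z0==v
    indexOf-just Z (suc n) refl | true = s≤s z≤n , ==⇒≡ Z0==v
    ... | false with indexOf (Z ∘ suc) n v in found′
    indexOf-just Z (suc n) refl | false | just k with k<n , Zk≡v ← indexOf-just (Z ∘ suc) n found′ =
      s≤s k<n , Zk≡v

    indexOf-nothing : ∀ Z n {v} → indexOf Z n v ≡ nothing → ∀ {k} → k < n → Z k ≢ v
    indexOf-nothing Z (suc n) {v} missing k<n with Z 0 == v in Z0==v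
    indexOf-nothing Z (suc n) () _ | true
    ... | false with indexOf (Z ∘ suc) n v in missing′
    indexOf-nothing Z (suc n) () _ | false | just _
    indexOf-nothing Z (suc n) _ {zero}  _         | false | nothing = ==-false⇒≢ Z0==v
    indexOf-nothing Z (suc n) _ {suc k} (s≤s k<n) | false | nothing = indexOf-nothing (Z ∘ suc) n missing′ k<n

    indexOf-at : ∀ Z n → InjectiveBelow Z n → ∀ {k} → k < n → indexOf Z n (Z k) ≡ just k
    indexOf-at Z n injective {k} k<n with indexOf Z n (Z k) in found
    ... | nothing = contradiction refl (indexOf-nothing Z n found k<n)
    ... | just j with j<n , Zj≡Zk ← indexOf-just Z n found with <-cmp j k
    ...   | tri< j<k _ _ = contradiction Zj≡Zk (injective j<k k<n)
    ...   | tri≈ _ refl _ = refl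
    ...   | tri> _ _ k<j = contradiction (sym Zj≡Zk) (injective k<j j<n)

    indexOf-cong : ∀ {Z Z′} n → (∀ {k} → k < n → Z k ≡ Z′ k) → ∀ v → indexOf Z n v ≡ indexOf Z′ n v
    indexOf-cong zero    Z≗Z′ v = refl
    indexOf-cong (suc n) Z≗Z′ v rewrite Z≗Z′ {0} (s≤s z≤n) | indexOf-cong n (Z≗Z′ ∘ s≤s) v = refl

    prefixThrough : Fin N → (ℕ → Fin N) → ℕ → List (Fin N)
    prefixThrough y Z zero    = Z 0 ∷ []
    prefixThrough y Z (suc n) = if Z 0 == y then Z 0 ∷ [] else Z 0 ∷ prefixThrough y (Z ∘ suc) n

    prefixThrough-applyUpTo : ∀ y Z {L n} → Z L ≡ y → (∀ {k} → k < L → Z k ≢ y) → L ≤ n →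
                              prefixThrough y Z n ≡ applyUpTo Z (suc L)
    prefixThrough-applyUpTo y Z {zero} {zero}  _ _ _ = refl
    prefixThrough-applyUpTo y Z {zero} {suc n} ZL≡y _ _ rewrite ZL≡y | ==-refl y = refl
    prefixThrough-applyUpTo y Z {suc L} {suc n} ZL≡y before (s≤s L≤n)
      rewrite ≢⇒==-false (before {0} (s≤s z≤n)) =
      cong (Z 0 ∷_) (prefixThrough-applyUpTo y (Z ∘ suc) ZL≡y (before ∘ s≤s) L≤n)

  -- S = V(H), mH = M_H, x = a_i, y = a_j and T = V(H_ij).
  module AlternatingPaths {N : ℕ} (G : Graph N) (S : VSet N) (mH : Vec (Fin N) N)
                          (mH-perfect : IsPerfectMatching G S (lookup mH))
                          (x y : Fin N) (x≢y : x ≢ y) (T : VSet N)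
                          (T-x : T x ≡ not (S x)) (T-y : T y ≡ not (S y))
                          (T-inner : ∀ {v} → v ≢ x → v ≢ y → T v ≡ S v) where

    h : Fin N → Fin N
    h = lookup mH

    module H = IsPerfectMatching mH-perfect

    S≢T⇒endpoint : ∀ {v} → S v ≢ T v → v ≡ x ⊎ v ≡ y
    S≢T⇒endpoint {v} S≢T = decide (v ≟ x) (v ≟ y)
      where
      decide : Dec (v ≡ x) → Dec (v ≡ y) → v ≡ x ⊎ v ≡ y
      decide (yes v≡x) _         = inj₁ v≡x
      decide (no _)    (yes v≡y) = inj₂ v≡y
      decide (no v≢x)  (no v≢y)  = contradiction (sym (T-inner v≢x v≢y)) S≢T

    inM⇒h : ∀ {u v} → inM mH u v ≡ true → h u ≡ v
    inM⇒h {u} {v} u-v∈M with h u == v in hu==v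
    ... | true  = ==⇒≡ hu==v
    ... | false = trans (cong h (sym (==⇒≡ u-v∈M))) (H.involutive v)

    h⇒inM : ∀ {u v} → h u ≡ v → inM mH u v ≡ true
    h⇒inM {u} refl rewrite ==-refl (h u) = refl

    inM-sym : ∀ u v → inM mH u v ≡ inM mH v u
    inM-sym u v = ∨-comm (h u == v) (h v == u)

    endpoint-inM : ∀ {u v} → v ≢ u → (not (S u) ∨ inM mH u v) ≡ true → inM mH u v ≡ S u
    endpoint-inM {u} {v} v≢u condition with S u in Su
    ... | true  = condition
    ... | false with inM mH u v in u-v∈M
    ...   | true  = contradiction (trans (sym (inM⇒h u-v∈M)) (H.fixes u Su)) v≢u
    ...   | false = refl

    phase : ℕ → Bool
    phase = alternate (S x)

    alternatingPath : List (Fin N) → Bool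
    alternatingPath P =
      atLeastTwo P ∧ allDistinct P ∧ adjChain G P
      ∧ startsWith x P ∧ startsWith y (reverse P)
      ∧ alternating mH P
      ∧ (not (S x) ∨ firstEdgeInM mH P)
      ∧ (not (S y) ∨ firstEdgeInM mH (reverse P))

    -- in-M-at 0 and ends-in-M encode that the path uses the M_H-edge at an endpoint in V(H).
    record IsAltPathSeq (Z : ℕ → Fin N) (l : ℕ) : Set where
      field
        starts    : Z 0 ≡ x
        ends      : Z (suc l) ≡ y
        injective : InjectiveBelow Z (suc (suc l))
        adjacent  : ∀ {k} → k ≤ l → adj G (Z k) (Z (suc k)) ≡ true
        in-M-at   : ∀ {k} → k ≤ l → edgeInM mH Z k ≡ phase k
        ends-in-M : phase l ≡ S y

    reverse-applyUpTo-2+ : ∀ (Z : ℕ → Fin N) l →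
      reverse (applyUpTo Z (suc (suc l))) ≡ Z (suc l) ∷ Z l ∷ applyDownFrom Z l
    reverse-applyUpTo-2+ Z l = List.reverse-applyUpTo Z (suc (suc l))

    applyUpTo⇒IsAltPathSeq : ∀ Z l → alternatingPath (applyUpTo Z (suc (suc l))) ≡ true → IsAltPathSeq Z l
    applyUpTo⇒IsAltPathSeq Z l alt-Q
      with ∧-split₇ (allDistinct Q) (adjChain G Q) (startsWith x Q) (startsWith y (reverse Q))
                    (alternating mH Q) (not (S x) ∨ firstEdgeInM mH Q) alt-Q
      where
      Q : List (Fin N)
      Q = applyUpTo Z (suc (suc l))
    ... | distinct , chain , Z0==x , reverse-Q-starts-y , alternates , x-condition , y-condition = record
      { starts    = starts
      ; ends      = ends
      ; injective = injective
      ; adjacent  = Equivalence.to (adjChain-applyUpTo G Z (suc l)) chain ∘ s≤s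
      ; in-M-at   = in-M-at
      ; ends-in-M = begin
          phase l                  ≡⟨ in-M-at ≤-refl ⟨
          inM mH (Z l) (Z (suc l)) ≡⟨ inM-sym (Z l) (Z (suc l)) ⟩
          inM mH (Z (suc l)) (Z l) ≡⟨ endpoint-inM (injective ≤-refl ≤-refl) y-condition′ ⟩
          S (Z (suc l))            ≡⟨ cong S ends ⟩
          S y                      ∎
      }
      where
      open ≡-Reasoning
      starts : Z 0 ≡ x
      starts = ==⇒≡ Z0==x
      ends : Z (suc l) ≡ y
      ends = ==⇒≡ (subst (λ R → startsWith y R ≡ true) (reverse-applyUpTo-2+ Z l) reverse-Q-starts-y)
      injective : InjectiveBelow Z (suc (suc l))
      injective = Unique-applyUpTo⁻ Z (suc (suc l)) (Equivalence.to (allDistinct⇔Unique _) distinct)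
      x-condition′ : (not (S (Z 0)) ∨ inM mH (Z 0) (Z 1)) ≡ true
      x-condition′ = subst (λ u → (not (S u) ∨ inM mH (Z 0) (Z 1)) ≡ true) (sym starts) x-condition
      y-condition′ : (not (S (Z (suc l))) ∨ inM mH (Z (suc l)) (Z l)) ≡ true
      y-condition′ = subst (λ u → (not (S u) ∨ inM mH (Z (suc l)) (Z l)) ≡ true) (sym ends)
        (subst (λ R → (not (S y) ∨ firstEdgeInM mH R) ≡ true) (reverse-applyUpTo-2+ Z l) y-condition)
      in-M-at : ∀ {k} → k ≤ l → edgeInM mH Z k ≡ phase k
      in-M-at {k} k≤l = begin
        edgeInM mH Z k                 ≡⟨ Equivalence.to (alternating-applyUpTo mH Z l) alternates k≤l ⟩
        alternate (edgeInM mH Z 0) k   ≡⟨ cong (λ b → alternate b k) (endpoint-inM (injective (s≤s z≤n) (s≤s (s≤s z≤n)) ∘ sym) x-condition′) ⟩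
        alternate (S (Z 0)) k          ≡⟨ cong (λ u → alternate (S u) k) starts ⟩
        phase k                        ∎

    alternatingPath⇒IsAltPathSeq : ∀ P → alternatingPath P ≡ true →
      ∃[ l ] length P ≡ suc (suc l) × IsAltPathSeq (at x P) l
    alternatingPath⇒IsAltPathSeq P@(_ ∷ _ ∷ rest) alt-P =
      length rest , refl ,
      applyUpTo⇒IsAltPathSeq (at x P) (length rest)
        (subst (λ R → alternatingPath R ≡ true) (sym (applyUpTo-at x P)) alt-P)

    IsAltPathSeq⇒alternatingPath : ∀ {Z l} → IsAltPathSeq Z l → alternatingPath (applyUpTo Z (suc (suc l))) ≡ true
    IsAltPathSeq⇒alternatingPath {Z} {l} seq =
      ∧-intro distinct (∧-intro chain (∧-intro Z0==x (∧-intro reverse-Q-starts-y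
        (∧-intro alternates (∧-intro x-condition y-condition)))))
      where
      open IsAltPathSeq seq
      Q : List (Fin N)
      Q = applyUpTo Z (suc (suc l))
      distinct : allDistinct Q ≡ true
      distinct = Equivalence.from (allDistinct⇔Unique Q) (Unique.applyUpTo⁺₁ Z (suc (suc l)) injective)
      chain : adjChain G Q ≡ true
      chain = Equivalence.from (adjChain-applyUpTo G Z (suc l)) (adjacent ∘ ≤-pred)
      Z0==x : startsWith x Q ≡ true
      Z0==x = trans (cong (_== x) starts) (==-refl x)
      reverse-Q-starts-y : startsWith y (reverse Q) ≡ true
      reverse-Q-starts-y = trans (cong (startsWith y) (reverse-applyUpTo-2+ Z l))
                                 (trans (cong (_== y) ends) (==-refl y))
      alternates : alternating mH Q ≡ true
      alternates = Equivalence.from (alternating-applyUpTo mH Z l)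
        (λ {k} k≤l → trans (in-M-at k≤l) (cong (λ b → alternate b k) (sym (in-M-at z≤n))))
      x-condition : (not (S x) ∨ firstEdgeInM mH Q) ≡ true
      x-condition = trans (cong (not (S x) ∨_) (in-M-at z≤n)) (∨-inverseˡ (S x))
      y-condition : (not (S y) ∨ firstEdgeInM mH (reverse Q)) ≡ true
      y-condition = begin
        not (S y) ∨ firstEdgeInM mH (reverse Q)  ≡⟨ cong (λ R → not (S y) ∨ firstEdgeInM mH R) (reverse-applyUpTo-2+ Z l) ⟩
        not (S y) ∨ inM mH (Z (suc l)) (Z l)     ≡⟨ cong (not (S y) ∨_) (inM-sym (Z (suc l)) (Z l)) ⟩
        not (S y) ∨ edgeInM mH Z l               ≡⟨ cong (not (S y) ∨_) (trans (in-M-at ≤-refl) ends-in-M) ⟩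
        not (S y) ∨ S y                          ≡⟨ ∨-inverseˡ (S y) ⟩
        true                                     ∎
        where open ≡-Reasoning

    stepWith : (Fin N → Fin N) → Bool → Fin N → Fin N
    stepWith m true  = h
    stepWith m false = m

    walkWith : (Fin N → Fin N) → ℕ → Fin N
    walkWith m = zigzag (stepWith m) (S x) x

    -- How vertex k of a path with edges 0 … l meets the edges of colour b, where the k-th edge has
    -- colour phase k (true: in M_H); interior vertices meet exactly one edge of each colour.
    data Incidence (l : ℕ) (b : Bool) : ℕ → Set where
      forward         : ∀ {k} → k ≤ l → phase k ≡ b → Incidence l b k
      backward        : ∀ {k} → k ≤ l → phase k ≡ b → Incidence l b (suc k)
      start-unmatched : phase 0 ≡ not b → Incidence l b 0
      end-unmatched   : phase l ≡ not b → Incidence l b (suc l)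

    incidence : ∀ l b {k} → k ≤ suc l → Incidence l b k
    incidence l b {zero} _ with phase 0 Data.Bool.≟ b
    ... | yes phase≡b = forward z≤n phase≡b
    ... | no  phase≢b = start-unmatched (¬-not phase≢b)
    incidence l b {suc k} (s≤s k≤l) with phase k Data.Bool.≟ b
    ... | yes phase≡b = backward k≤l phase≡b
    ... | no  phase≢b with m≤n⇒m<n∨m≡n k≤l
    ...   | inj₂ refl = end-unmatched (¬-not phase≢b)
    ...   | inj₁ k<l  = forward k<l (trans (cong not (¬-not phase≢b)) (not-involutive b))

    -- the neighbour of vertex k along its edge outside M_H, or vertex k itself if it has none
    partner : (ℕ → Fin N) → ℕ → ℕ → Fin N
    partner Z l zero    = if phase 0 then Z 0 else Z 1
    partner Z l (suc k) = if phase k then (if k <ᵇ l then Z (suc (suc k)) else Z (suc k)) else Z k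

    module _ (Z : ℕ → Fin N) (l : ℕ) where

      partner-forward : ∀ {k} → k ≤ l → phase k ≡ false → partner Z l k ≡ Z (suc k)
      partner-forward {zero}  _   phase≡false rewrite phase≡false = refl
      partner-forward {suc k} k<l phase≡false
        rewrite not-injective {phase k} {true} phase≡false
              | Equivalence.to T-≡ (<⇒<ᵇ k<l) = refl

      partner-backward : ∀ {k} → phase k ≡ false → partner Z l (suc k) ≡ Z k
      partner-backward phase≡false rewrite phase≡false = refl

      partner-start : phase 0 ≡ true → partner Z l 0 ≡ Z 0
      partner-start phase≡true rewrite phase≡true = refl

      partner-end : phase l ≡ true → partner Z l (suc l) ≡ Z (suc l)
      partner-end phase≡true rewrite phase≡true with l <ᵇ l in l<l
      ... | true  = contradiction (<ᵇ⇒< l l (Equivalence.from T-≡ l<l)) (<-irrefl refl)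
      ... | false = refl

    -- h with every M_H-edge of the path Z 0 … Z (suc l) replaced by the other edges of the path.
    flipAlong : (ℕ → Fin N) → ℕ → Fin N → Fin N
    flipAlong Z l v = maybe′ (partner Z l) (h v) (indexOf Z (suc (suc l)) v)

    flipAlong-cong : ∀ {Z Z′} l → (∀ {k} → k < suc (suc l) → Z k ≡ Z′ k) →
                     ∀ v → flipAlong Z l v ≡ flipAlong Z′ l v
    flipAlong-cong {Z} {Z′} l Z≗Z′ v
      rewrite indexOf-cong (suc (suc l)) Z≗Z′ v with indexOf Z′ (suc (suc l)) v in found
    ... | nothing = refl
    ... | just k  = partner-cong k (proj₁ (indexOf-just Z′ (suc (suc l)) found))
      where
      partner-cong : ∀ k → k < suc (suc l) → partner Z l k ≡ partner Z′ l k
      partner-cong zero    _ rewrite Z≗Z′ {0} (s≤s z≤n) | Z≗Z′ {1} (s≤s (s≤s z≤n)) = refl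
      partner-cong (suc k) (s≤s k<1+l) with phase k | k <ᵇ l in k<l
      ... | true  | true  = Z≗Z′ (s≤s (s≤s (<ᵇ⇒< k l (Equivalence.from T-≡ k<l))))
      ... | true  | false = Z≗Z′ (s≤s k<1+l)
      ... | false | _     = Z≗Z′ (≤-trans (n≤1+n _) (s≤s k<1+l))

    module OnAltPathSeq {Z : ℕ → Fin N} {l : ℕ} (seq : IsAltPathSeq Z l) where

      open IsAltPathSeq seq

      neighbour : ∀ {b k} → Incidence l b k → Fin N
      neighbour (forward {k} _ _)  = Z (suc k)
      neighbour (backward {k} _ _) = Z k
      neighbour (start-unmatched _) = Z 0
      neighbour (end-unmatched _)   = Z (suc l)

      neighbour-on-path : ∀ {b k} (i : Incidence l b k) → ∃[ j ] j < suc (suc l) × neighbour i ≡ Z j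
      neighbour-on-path (forward k≤l _)     = _ , s≤s (s≤s k≤l) , refl
      neighbour-on-path (backward k≤l _)    = _ , s≤s (m≤n⇒m≤1+n k≤l) , refl
      neighbour-on-path (start-unmatched _) = 0 , s≤s z≤n , refl
      neighbour-on-path (end-unmatched _)   = suc l , ≤-refl , refl

      data Position (v : Fin N) : Set where
        on-path  : ∀ {k} → k ≤ suc l → Z k ≡ v → Position v
        off-path : indexOf Z (suc (suc l)) v ≡ nothing → Position v

      position : ∀ v → Position v
      position v with indexOf Z (suc (suc l)) v in found
      ... | nothing = off-path found
      ... | just k  = on-path (≤-pred (proj₁ (indexOf-just Z (suc (suc l)) found))) (proj₂ (indexOf-just Z (suc (suc l)) found))

      record FollowsPath (b : Bool) (τ : Fin N → Fin N) : Set where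
        field
          involutive : ∀ v → τ (τ v) ≡ v
          along      : ∀ {k} → k ≤ l → phase k ≡ b → τ (Z k) ≡ Z (suc k)
          fixes-x    : phase 0 ≡ not b → τ x ≡ x
          fixes-y    : phase l ≡ not b → τ y ≡ y

        to-neighbour : ∀ {k} (i : Incidence l b k) → τ (Z k) ≡ neighbour i
        to-neighbour (forward k≤l p)     = along k≤l p
        to-neighbour (backward k≤l p)    = trans (cong τ (sym (along k≤l p))) (involutive _)
        to-neighbour (start-unmatched p) = trans (cong τ starts) (trans (fixes-x p) (sym starts))
        to-neighbour (end-unmatched p)   = trans (cong τ ends) (trans (fixes-y p) (sym ends))

        preserves-on-path : ∀ {k} → k ≤ suc l → ∃[ j ] j < suc (suc l) × τ (Z k) ≡ Z j
        preserves-on-path k≤1+l with j , j<2+l , nb≡Zj ← neighbour-on-path (incidence l b k≤1+l) =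
          j , j<2+l , trans (to-neighbour (incidence l b k≤1+l)) nb≡Zj

        preserves-off-path : ∀ {v} → indexOf Z (suc (suc l)) v ≡ nothing → indexOf Z (suc (suc l)) (τ v) ≡ nothing
        preserves-off-path {v} missing with indexOf Z (suc (suc l)) (τ v) in found
        ... | nothing = refl
        ... | just k with k<2+l , Zk≡τv ← indexOf-just Z (suc (suc l)) found
                     with j , j<2+l , τZk≡Zj ← preserves-on-path (≤-pred k<2+l) =
          contradiction (begin
            Z j          ≡⟨ τZk≡Zj ⟨
            τ (Z k)      ≡⟨ cong τ Zk≡τv ⟩
            τ (τ v)      ≡⟨ involutive v ⟩
            v            ∎) (indexOf-nothing Z (suc (suc l)) missing j<2+l)
          where open ≡-Reasoning

      h-follows : FollowsPath true h
      h-follows = record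
        { involutive = H.involutive
        ; along      = λ k≤l phase≡true → inM⇒h (trans (in-M-at k≤l) phase≡true)
        ; fixes-x    = λ phase≡false → H.fixes x phase≡false
        ; fixes-y    = λ phase≡false → H.fixes y (trans (sym ends-in-M) phase≡false)
        }

      flipAlong-at : ∀ {k} → k ≤ suc l → flipAlong Z l (Z k) ≡ partner Z l k
      flipAlong-at k≤1+l rewrite indexOf-at Z (suc (suc l)) injective (s≤s k≤1+l) = refl

      flipAlong-off : ∀ {v} → indexOf Z (suc (suc l)) v ≡ nothing → flipAlong Z l v ≡ h v
      flipAlong-off missing rewrite missing = refl

      flipAlong-to-neighbour : ∀ {k} (i : Incidence l false k) → flipAlong Z l (Z k) ≡ neighbour i
      flipAlong-to-neighbour (forward k≤l p)     = trans (flipAlong-at (m≤n⇒m≤1+n k≤l)) (partner-forward Z l k≤l p)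
      flipAlong-to-neighbour (backward k≤l p)    = trans (flipAlong-at (s≤s k≤l)) (partner-backward Z l p)
      flipAlong-to-neighbour (start-unmatched p) = trans (flipAlong-at z≤n) (partner-start Z l p)
      flipAlong-to-neighbour (end-unmatched p)   = trans (flipAlong-at ≤-refl) (partner-end Z l p)

      flipAlong-back : ∀ {k} (i : Incidence l false k) → flipAlong Z l (neighbour i) ≡ Z k
      flipAlong-back (forward k≤l p)       = trans (flipAlong-at (s≤s k≤l)) (partner-backward Z l p)
      flipAlong-back (backward k≤l p)      = trans (flipAlong-at (m≤n⇒m≤1+n k≤l)) (partner-forward Z l k≤l p)
      flipAlong-back i@(start-unmatched _) = flipAlong-to-neighbour i
      flipAlong-back i@(end-unmatched _)   = flipAlong-to-neighbour i

      flipAlong-involutive : ∀ v → flipAlong Z l (flipAlong Z l v) ≡ v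
      flipAlong-involutive v with position v
      ... | off-path missing = begin
        flipAlong Z l (flipAlong Z l v)  ≡⟨ cong (flipAlong Z l) (flipAlong-off missing) ⟩
        flipAlong Z l (h v)              ≡⟨ flipAlong-off (FollowsPath.preserves-off-path h-follows missing) ⟩
        h (h v)                          ≡⟨ H.involutive v ⟩
        v                                ∎
        where open ≡-Reasoning
      ... | on-path k≤1+l refl =
        trans (cong (flipAlong Z l) (flipAlong-to-neighbour i)) (flipAlong-back i)
        where
        i : Incidence l false _
        i = incidence l false k≤1+l

      flipAlong-follows : FollowsPath false (flipAlong Z l)
      flipAlong-follows = record
        { involutive = flipAlong-involutive
        ; along      = λ k≤l p → flipAlong-to-neighbour (forward k≤l p)
        ; fixes-x    = λ p → subst (λ u → flipAlong Z l u ≡ u) starts (flipAlong-to-neighbour (start-unmatched p))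
        ; fixes-y    = λ p → subst (λ u → flipAlong Z l u ≡ u) ends (flipAlong-to-neighbour (end-unmatched p))
        }

      inner-≢x : ∀ {k} → 0 < k → k ≤ suc l → Z k ≢ x
      inner-≢x 0<k k≤1+l Zk≡x = injective 0<k (s≤s k≤1+l) (trans starts (sym Zk≡x))

      inner-≢y : ∀ {k} → k ≤ l → Z k ≢ y
      inner-≢y k≤l Zk≡y = injective (s≤s k≤l) ≤-refl (trans Zk≡y (sym ends))

      S-along-M : ∀ {k} → k ≤ l → phase k ≡ true → S (Z k) ≡ true × S (Z (suc k)) ≡ true
      S-along-M k≤l p = S-Zk , trans (cong S (sym h-Zk)) (trans (H.preserves _) S-Zk)
        where
        h-Zk : h (Z _) ≡ Z (suc _)
        h-Zk = FollowsPath.along h-follows k≤l p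
        S-Zk : S (Z _) ≡ true
        S-Zk = H.moved⇒∈ (λ h-Zk≡Zk → injective ≤-refl (s≤s (s≤s k≤l)) (trans (sym h-Zk≡Zk) h-Zk))

      T-forward : ∀ {k} → k ≤ l → phase k ≡ false → T (Z k) ≡ true
      T-forward {zero}  _   p = trans (cong T starts) (trans T-x (cong not p))
      T-forward {suc k} k<l p = trans (T-inner (inner-≢x (s≤s z≤n) (m≤n⇒m≤1+n k<l)) (inner-≢y k<l))
                                      (proj₂ (S-along-M (<⇒≤ k<l) (not-injective {phase k} {true} p)))

      T-backward : ∀ {k} → k ≤ l → phase k ≡ false → T (Z (suc k)) ≡ true
      T-backward {k} k≤l p with m≤n⇒m<n∨m≡n k≤l
      ... | inj₂ refl = trans (cong T ends) (trans T-y (cong not (trans (sym ends-in-M) p)))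
      ... | inj₁ k<l  = trans (T-inner (inner-≢x (s≤s z≤n) (s≤s k≤l)) (inner-≢y k<l))
                              (proj₁ (S-along-M k<l (cong not p)))

      T-x-unmatched : phase 0 ≡ true → T x ≡ false
      T-x-unmatched p = trans T-x (cong not p)

      T-y-unmatched : phase l ≡ true → T y ≡ false
      T-y-unmatched p = trans T-y (cong not (trans (sym ends-in-M) p))

      T-off-path : ∀ {v} → indexOf Z (suc (suc l)) v ≡ nothing → T v ≡ S v
      T-off-path missing =
        T-inner (λ v≡x → indexOf-nothing Z (suc (suc l)) missing (s≤s z≤n) (trans starts (sym v≡x)))
                (λ v≡y → indexOf-nothing Z (suc (suc l)) missing ≤-refl (trans ends (sym v≡y)))

      flipAlong-perfect : IsPerfectMatching G T (flipAlong Z l)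
      flipAlong-perfect = record { covers = covers ; fixes = fixes }
        where
        F : Fin N → Fin N
        F = flipAlong Z l
        covers : ∀ v → T v ≡ true → T (F v) ≡ true × adj G v (F v) ≡ true × F (F v) ≡ v
        covers v Tv with position v
        ... | off-path missing rewrite flipAlong-off missing =
          trans (T-off-path (FollowsPath.preserves-off-path h-follows missing)) (trans (H.preserves v) Sv) ,
          proj₁ (proj₂ (H.covers v Sv)) ,
          trans (cong F (sym (flipAlong-off missing))) (flipAlong-involutive v)
          where
          Sv : S v ≡ true
          Sv = trans (sym (T-off-path missing)) Tv
        ... | on-path k≤1+l refl with incidence l false k≤1+l
        ...   | forward k≤l p  rewrite flipAlong-to-neighbour (forward k≤l p) =
          T-backward k≤l p , adjacent k≤l , flipAlong-back (forward k≤l p)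
        ...   | backward k≤l p rewrite flipAlong-to-neighbour (backward k≤l p) =
          T-forward k≤l p , trans (Graph.sym G _ _) (adjacent k≤l) , flipAlong-back (backward k≤l p)
        ...   | start-unmatched p = contradiction (trans (sym Tv) (trans (cong T starts) (T-x-unmatched p))) λ ()
        ...   | end-unmatched p   = contradiction (trans (sym Tv) (trans (cong T ends) (T-y-unmatched p))) λ ()
        fixes : ∀ v → T v ≡ false → F v ≡ v
        fixes v Tv with position v
        ... | off-path missing = trans (flipAlong-off missing) (H.fixes v (trans (sym (T-off-path missing)) Tv))
        ... | on-path k≤1+l refl with incidence l false k≤1+l
        ...   | forward k≤l p        = contradiction (trans (sym Tv) (T-forward k≤l p)) λ ()
        ...   | backward k≤l p       = contradiction (trans (sym Tv) (T-backward k≤l p)) λ ()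
        ...   | i@(start-unmatched _) = flipAlong-to-neighbour i
        ...   | i@(end-unmatched _)   = flipAlong-to-neighbour i

      walkWith-along : ∀ m → (∀ {k} → k ≤ l → phase k ≡ false → m (Z k) ≡ Z (suc k)) →
                       ∀ {k} → k ≤ suc l → walkWith m k ≡ Z k
      walkWith-along m m-along {zero}  _ = sym starts
      walkWith-along m m-along {suc k} (s≤s k≤l) with phase k in p
      ... | true  = trans (cong h (walkWith-along m m-along (m≤n⇒m≤1+n k≤l))) (FollowsPath.along h-follows k≤l p)
      ... | false = trans (cong m (walkWith-along m m-along (m≤n⇒m≤1+n k≤l))) (m-along k≤l p)

    module FromMatching (m : Fin N → Fin N) (m-perfect : IsPerfectMatching G T m) where

      module Hij = IsPerfectMatching m-perfect

      walk : ℕ → Fin N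
      walk = walkWith m

      step-involutive : ∀ b v → stepWith m b (stepWith m b v) ≡ v
      step-involutive true  = H.involutive
      step-involutive false = Hij.involutive

      step-adjacent : ∀ b {v} → stepWith m b v ≢ v → adj G v (stepWith m b v) ≡ true
      step-adjacent true  = H.adjacent
      step-adjacent false = Hij.adjacent

      x-fixed : stepWith m (not (S x)) x ≡ x
      x-fixed = fixed (S x) refl
        where
        fixed : ∀ b → S x ≡ b → stepWith m (not b) x ≡ x
        fixed true  Sx = Hij.fixes x (trans T-x (cong not Sx))
        fixed false Sx = H.fixes x Sx

      first-step-moves : walk 1 ≢ walk 0
      first-step-moves = moves (S x) refl
        where
        moves : ∀ b → S x ≡ b → stepWith m b x ≢ x
        moves true  Sx = H.∈⇒moved Sx
        moves false Sx = Hij.∈⇒moved (trans T-x (cong not Sx))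

      half-covered⇒endpoint : ∀ b {v} → stepWith m b v ≢ v → stepWith m (not b) v ≡ v → v ≡ x ⊎ v ≡ y
      half-covered⇒endpoint true  moved fixed = S≢T⇒endpoint λ S≡T →
        contradiction (trans (sym (H.moved⇒∈ moved)) (trans S≡T (Hij.fixed⇒∉ fixed))) λ ()
      half-covered⇒endpoint false moved fixed = S≢T⇒endpoint λ S≡T →
        contradiction (trans (sym (H.fixed⇒∉ fixed)) (trans S≡T (Hij.moved⇒∈ moved))) λ ()

      Fresh : ℕ → Set
      Fresh K = ∀ {s} → s < K → walk (suc s) ≢ walk s × walk s ≢ y

      fresh-injective : ∀ {K} → Fresh K → InjectiveBelow walk (suc K)
      fresh-injective {K} fresh = zigzag-injective (stepWith m) step-involutive (S x) x x-fixed K (λ _ → proj₁ ∘ fresh)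

      -- At a stall at v = walk (K + 1), the step that reached v moves it and the next step fixes it,
      -- so v is x (a repetition) or y.
      fresh⇒no-stall : ∀ K → Fresh K → walk K ≢ y → walk (suc K) ≢ walk K
      fresh⇒no-stall zero    _     _   = first-step-moves
      fresh⇒no-stall (suc K) fresh K≢y stalled with half-covered⇒endpoint (alternate (S x) K) moved stalled
        where
        moved : stepWith m (alternate (S x) K) (walk (suc K)) ≢ walk (suc K)
        moved back≡ = proj₁ (fresh ≤-refl) (trans (sym back≡) (zigzag-back (stepWith m) step-involutive (S x) x K))
      ... | inj₁ at-x = fresh-injective fresh (s≤s z≤n) ≤-refl (sym at-x)
      ... | inj₂ at-y = K≢y at-y

      fresh-step : ∀ {K} → Fresh K → walk K ≢ y → Fresh (suc K)
      fresh-step {K} fresh K≢y {s} (s≤s s≤K) with m≤n⇒m<n∨m≡n s≤K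
      ... | inj₁ s<K  = fresh s<K
      ... | inj₂ refl = fresh⇒no-stall K fresh K≢y , K≢y

      reaches-y : ∃[ l ] Fresh (suc l) × walk (suc l) ≡ y
      reaches-y with search N 0 (λ ()) (+-identityʳ N)
        where
        search : ∀ fuel K → Fresh K → fuel + K ≡ N → ∃[ L ] Fresh L × walk L ≡ y
        search fuel K fresh fuel+K≡N with walk K ≟ y
        ... | yes K≡y = K , fresh , K≡y
        ... | no  K≢y with fuel
        ...   | zero      = contradiction (InjectiveBelow-bound walk (suc K) (fresh-injective fresh)) (<-irrefl fuel+K≡N)
        ...   | suc fuel′ = search fuel′ (suc K) (fresh-step fresh K≢y) (trans (+-suc fuel′ K) fuel+K≡N)
      ... | zero  , _     , x≡y     = contradiction x≡y x≢y
      ... | suc l , fresh , reached = l , fresh , reached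

      l : ℕ
      l = proj₁ reaches-y

      fresh : Fresh (suc l)
      fresh = proj₁ (proj₂ reaches-y)

      reached : walk (suc l) ≡ y
      reached = proj₂ (proj₂ reaches-y)

      last-step-moves-y : ∀ {b} → phase l ≡ b → stepWith m b y ≢ y
      last-step-moves-y {b} refl y-fixed = proj₁ (fresh ≤-refl) (begin
        walk (suc l)                             ≡⟨ reached ⟩
        y                                        ≡⟨ y-fixed ⟨
        stepWith m (phase l) y                   ≡⟨ cong (stepWith m (phase l)) reached ⟨
        stepWith m (phase l) (walk (suc l))      ≡⟨ zigzag-back (stepWith m) step-involutive (S x) x l ⟩
        walk l                                   ∎)
        where open ≡-Reasoning

      ends-in-M : phase l ≡ S y
      ends-in-M with phase l in p
      ... | true  = sym (H.moved⇒∈ (last-step-moves-y p))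
      ... | false = sym (not-injective {S y} {false} (trans (sym T-y) (Hij.moved⇒∈ (last-step-moves-y p))))

      in-M-at : ∀ {k} → k ≤ l → edgeInM mH walk k ≡ phase k
      in-M-at {k} k≤l with phase k in p
      ... | true  = h⇒inM refl
      ... | false with inM mH (walk k) (m (walk k)) in in-M
      ...   | false = refl
      ...   | true with m≤n⇒m<n∨m≡n k≤l
      ...     | inj₁ k<l = contradiction (begin
        walk k                 ≡⟨ H.involutive (walk k) ⟨
        h (h (walk k))         ≡⟨ cong h (inM⇒h in-M) ⟩
        h (m (walk k))         ≡⟨ cong (λ b → stepWith m (not b) (stepWith m b (walk k))) p ⟨
        walk (suc (suc k))     ∎) (fresh-injective fresh (n≤1+n (suc k)) (s≤s (s≤s k<l)))
        where open ≡-Reasoning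
      ...     | inj₂ refl = contradiction
        (trans (sym (cong not (H.moved⇒∈ h-moves-y))) (trans (sym T-y) (Hij.moved⇒∈ (last-step-moves-y p)))) λ ()
        where
        h-last≡y : h (walk l) ≡ y
        h-last≡y = trans (inM⇒h in-M) (trans (cong (λ b → stepWith m b (walk l)) (sym p)) reached)
        h-moves-y : h y ≢ y
        h-moves-y h-y≡y = proj₁ (fresh ≤-refl)
          (trans reached (trans (sym h-y≡y) (trans (cong h (sym h-last≡y)) (H.involutive (walk l)))))

      walk-seq : IsAltPathSeq walk l
      walk-seq = record
        { starts    = refl
        ; ends      = reached
        ; injective = fresh-injective fresh
        ; adjacent  = λ {k} k≤l → step-adjacent (phase k) (proj₁ (fresh (s≤s k≤l)))
        ; in-M-at   = in-M-at
        ; ends-in-M = ends-in-M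
        }

      open OnAltPathSeq walk-seq

      m-follows : FollowsPath false m
      m-follows = record
        { involutive = Hij.involutive
        ; along      = λ {k} _ p → cong (λ b → stepWith m b (walk k)) (sym p)
        ; fixes-x    = λ p → Hij.fixes x (trans T-x (cong not p))
        ; fixes-y    = λ p → Hij.fixes y (trans T-y (cong not (trans (sym ends-in-M) p)))
        }

      -- h on the path and m off it: a perfect matching of H, hence equal to M_H.
      spliced : Fin N → Fin N
      spliced v = maybe′ (λ _ → h v) (m v) (indexOf walk (suc (suc l)) v)

      spliced-on : ∀ {k} → k ≤ suc l → spliced (walk k) ≡ h (walk k)
      spliced-on k≤1+l rewrite indexOf-at walk (suc (suc l)) (fresh-injective fresh) (s≤s k≤1+l) = refl

      spliced-off : ∀ {v} → indexOf walk (suc (suc l)) v ≡ nothing → spliced v ≡ m v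
      spliced-off missing rewrite missing = refl

      spliced-perfect : IsPerfectMatching G S spliced
      spliced-perfect = record { covers = covers ; fixes = fixes }
        where
        covers : ∀ v → S v ≡ true → S (spliced v) ≡ true × adj G v (spliced v) ≡ true × spliced (spliced v) ≡ v
        covers v Sv with position v
        ... | on-path k≤1+l refl with j , j<2+l , h-Zk≡Zj ← FollowsPath.preserves-on-path h-follows k≤1+l
          rewrite spliced-on k≤1+l =
          trans (H.preserves _) Sv ,
          proj₁ (proj₂ (H.covers _ Sv)) ,
          trans (cong spliced h-Zk≡Zj) (trans (spliced-on (≤-pred j<2+l))
                (trans (cong h (sym h-Zk≡Zj)) (H.involutive _)))
        ... | off-path missing rewrite spliced-off missing =
          trans (sym (T-off-path m-missing)) (trans (Hij.preserves v) Tv) ,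
          proj₁ (proj₂ (Hij.covers v Tv)) ,
          trans (spliced-off m-missing) (Hij.involutive v)
          where
          Tv : T v ≡ true
          Tv = trans (T-off-path missing) Sv
          m-missing : indexOf walk (suc (suc l)) (m v) ≡ nothing
          m-missing = FollowsPath.preserves-off-path m-follows missing
        fixes : ∀ v → S v ≡ false → spliced v ≡ v
        fixes v Sv with position v
        ... | on-path k≤1+l refl = trans (spliced-on k≤1+l) (H.fixes _ Sv)
        ... | off-path missing   = trans (spliced-off missing) (Hij.fixes v (trans (T-off-path missing) Sv))

      module _ (mH-unique : ∀ m′ → isPM G S m′ ≡ true → m′ ≡ mH) where

        spliced≡h : ∀ v → spliced v ≡ h v
        spliced≡h v = begin
          spliced v                   ≡⟨ Vec.lookup∘tabulate spliced v ⟨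
          lookup (tabulate spliced) v ≡⟨ cong (λ m′ → lookup m′ v) (mH-unique (tabulate spliced) (IsPerfectMatching⇒isPM G S spliced-perfect)) ⟩
          h v                         ∎
          where open ≡-Reasoning

        flipAlong-walk : ∀ v → flipAlong walk l v ≡ m v
        flipAlong-walk v with position v
        ... | off-path missing = trans (flipAlong-off missing) (trans (sym (spliced≡h v)) (spliced-off missing))
        ... | on-path k≤1+l refl =
          trans (flipAlong-to-neighbour i) (sym (FollowsPath.to-neighbour m-follows i))
          where
          i : Incidence l false _
          i = incidence l false k≤1+l

    -- the edges of a path P are numbered 0 … length P ∸ 2
    toMatching : List (Fin N) → Vec (Fin N) N
    toMatching P = tabulate (flipAlong (at x P) (length P ∸ 2))

    toPath : Vec (Fin N) N → List (Fin N)
    toPath m = prefixThrough y (walkWith (lookup m)) N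

    module _ {P} (alt-P : alternatingPath P ≡ true) where

      private
        l : ℕ
        l = proj₁ (alternatingPath⇒IsAltPathSeq P alt-P)
        |P|≡2+l : length P ≡ suc (suc l)
        |P|≡2+l = proj₁ (proj₂ (alternatingPath⇒IsAltPathSeq P alt-P))
        seq : IsAltPathSeq (at x P) l
        seq = proj₂ (proj₂ (alternatingPath⇒IsAltPathSeq P alt-P))
        open OnAltPathSeq seq

      toMatching-flipAlong : toMatching P ≡ tabulate (flipAlong (at x P) l)
      toMatching-flipAlong = cong (λ n → tabulate (flipAlong (at x P) (n ∸ 2))) |P|≡2+l

      lookup-toMatching : ∀ v → lookup (toMatching P) v ≡ flipAlong (at x P) l v
      lookup-toMatching v = trans (cong (λ m → lookup m v) toMatching-flipAlong) (Vec.lookup∘tabulate _ v)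

      toMatching-perfect : isPM G T (toMatching P) ≡ true
      toMatching-perfect = subst (λ m → isPM G T m ≡ true) (sym toMatching-flipAlong)
                                 (IsPerfectMatching⇒isPM G T flipAlong-perfect)

      toPath∘toMatching : toPath (toMatching P) ≡ P
      toPath∘toMatching = begin
        prefixThrough y walk N           ≡⟨ prefixThrough-applyUpTo y walk (trans (walk≗Z ≤-refl) ends) before-y l<N ⟩
        applyUpTo walk (suc (suc l))     ≡⟨ applyUpTo-cong (suc (suc l)) (walk≗Z ∘ ≤-pred) ⟩
        applyUpTo (at x P) (suc (suc l)) ≡⟨ cong (applyUpTo (at x P)) |P|≡2+l ⟨
        applyUpTo (at x P) (length P)    ≡⟨ applyUpTo-at x P ⟩
        P                                ∎
        where
        open ≡-Reasoning
        open IsAltPathSeq seq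
        walk : ℕ → Fin N
        walk = walkWith (lookup (toMatching P))
        walk≗Z : ∀ {k} → k ≤ suc l → walk k ≡ at x P k
        walk≗Z = walkWith-along (lookup (toMatching P))
          (λ k≤l p → trans (lookup-toMatching _) (FollowsPath.along flipAlong-follows k≤l p))
        before-y : ∀ {k} → k < suc l → walk k ≢ y
        before-y k<1+l = inner-≢y (≤-pred k<1+l) ∘ trans (sym (walk≗Z (m≤n⇒m≤1+n (≤-pred k<1+l))))
        l<N : l < N
        l<N = ≤-pred (m≤n⇒m≤1+n (InjectiveBelow-bound (at x P) (suc (suc l)) injective))

      alternatingPath-listed : P ∈ allListsUpTo N
      alternatingPath-listed = ∈-allListsUpTo P
        (subst (_≤ N) (sym |P|≡2+l) (InjectiveBelow-bound (at x P) (suc (suc l)) (IsAltPathSeq.injective seq)))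

    module _ {m} (m-perfect : isPM G T m ≡ true) where

      open FromMatching (lookup m) (isPM⇒IsPerfectMatching G T m m-perfect)

      toPath-walk : toPath m ≡ applyUpTo walk (suc (suc l))
      toPath-walk = prefixThrough-applyUpTo y walk reached (proj₂ ∘ fresh)
        (≤-pred (m≤n⇒m≤1+n (InjectiveBelow-bound walk (suc (suc l)) (fresh-injective fresh))))

      toPath-alternating : alternatingPath (toPath m) ≡ true
      toPath-alternating = subst (λ P → alternatingPath P ≡ true) (sym toPath-walk) (IsAltPathSeq⇒alternatingPath walk-seq)

      toMatching∘toPath : (∀ m′ → isPM G S m′ ≡ true → m′ ≡ mH) → toMatching (toPath m) ≡ m
      toMatching∘toPath mH-unique = begin
        toMatching (toPath m)                                      ≡⟨ cong toMatching toPath-walk ⟩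
        tabulate (flipAlong (at x W) (length W ∸ 2))               ≡⟨ cong (λ n → tabulate (flipAlong (at x W) (n ∸ 2))) (List.length-applyUpTo walk (suc (suc l))) ⟩
        tabulate (flipAlong (at x W) l)                            ≡⟨ Vec.tabulate-cong (flipAlong-cong l (at-applyUpTo x walk)) ⟩
        tabulate (flipAlong walk l)                                ≡⟨ Vec.tabulate-cong (flipAlong-walk mH-unique) ⟩
        tabulate (lookup m)                                        ≡⟨ Vec.tabulate∘lookup m ⟩
        m                                                          ∎
        where
        open ≡-Reasoning
        W : List (Fin N)
        W = applyUpTo walk (suc (suc l))

    count-alternatingPaths : (∀ m′ → isPM G S m′ ≡ true → m′ ≡ mH) →
                             countᵇ alternatingPath (allListsUpTo N) ≡ M G T
    count-alternatingPaths mH-unique =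
      countᵇ-bijection alternatingPath (isPM G T) allListsUpTo-unique (allVecs-unique N)
        (λ P alt-P → alternatingPath-listed {P} alt-P) (λ m _ → ∈-allVecs m)
        toMatching toPath (λ P alt-P → toMatching-perfect {P} alt-P) (λ m m-perfect → toPath-alternating {m} m-perfect)
        (λ P alt-P → toPath∘toMatching {P} alt-P) (λ m m-perfect → toMatching∘toPath {m} m-perfect mH-unique)

  module Terminals {N n : ℕ} (a : Fin n → Fin N) (a-injective : ∀ k l → a k ≡ a l → k ≡ l)
                   (isK : Fin n → Bool) where

    inAK-terminal : ∀ k → inAK a isK (a k) ≡ isK k
    inAK-terminal k = ⇔→≡ {z = true} (mk⇔ in-AK⇒isK isK⇒in-AK)
      where
      in-AK⇒isK : inAK a isK (a k) ≡ true → isK k ≡ true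
      in-AK⇒isK in-AK with k′ , found ← anyᵇ-witness _ (allFin n) in-AK with ∧-split (isK k′) found
      ... | isK-k′ , ak′==ak rewrite a-injective k′ k (==⇒≡ ak′==ak) = isK-k′
      isK⇒in-AK : isK k ≡ true → inAK a isK (a k) ≡ true
      isK⇒in-AK isK-k = anyᵇ-∈ _ (∈-allFin k) (∧-intro isK-k (==-refl (a k)))

    VH-terminal : ∀ k → VH a isK (a k) ≡ not (isK k)
    VH-terminal k = cong not (inAK-terminal k)

    isK≡not-VH : ∀ k → isK k ≡ not (VH a isK (a k))
    isK≡not-VH k = trans (sym (not-involutive (isK k))) (cong not (sym (VH-terminal k)))

    module _ {i j : Fin n} (ai≢aj : a i ≢ a j) where

      VHij-at-i : VHij a isK i j (a i) ≡ isK i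
      VHij-at-i with isK i | isK j
      ... | true  | true  rewrite ==-refl (a i) = ∨-zeroʳ _
      ... | true  | false rewrite ==-refl (a i) = ∨-zeroʳ _
      ... | false | true  rewrite ==-refl (a i) | ≢⇒==-false ai≢aj = trans (∨-identityʳ _) (∧-zeroʳ _)
      ... | false | false rewrite ==-refl (a i) = ∧-zeroʳ _

      VHij-at-j : VHij a isK i j (a j) ≡ isK j
      VHij-at-j with isK i | isK j
      ... | true  | true  rewrite ==-refl (a j) = trans (cong (VH a isK (a j) ∨_) (∨-zeroʳ _)) (∨-zeroʳ _)
      ... | true  | false rewrite ==-refl (a j) | ≢⇒==-false (ai≢aj ∘ sym) = trans (∨-identityʳ _) (∧-zeroʳ _)
      ... | false | true  rewrite ==-refl (a j) = ∨-zeroʳ _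
      ... | false | false rewrite ==-refl (a j) | ≢⇒==-false (ai≢aj ∘ sym) = ∧-zeroʳ _

      VHij-inner : ∀ {v} → v ≢ a i → v ≢ a j → VHij a isK i j v ≡ VH a isK v
      VHij-inner {v} v≢ai v≢aj with isK i | isK j
      ... | true  | true  rewrite ≢⇒==-false v≢ai | ≢⇒==-false v≢aj = ∨-identityʳ _
      ... | true  | false rewrite ≢⇒==-false v≢ai | ≢⇒==-false v≢aj = trans (∨-identityʳ _) (∧-identityʳ _)
      ... | false | true  rewrite ≢⇒==-false v≢ai | ≢⇒==-false v≢aj = trans (∨-identityʳ _) (∧-identityʳ _)
      ... | false | false rewrite ≢⇒==-false v≢ai | ≢⇒==-false v≢aj = ∧-identityʳ _

open import Defs
open import Data.Bool using (Bool; true)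
open import Data.Nat using (ℕ)
open import Data.Nat.Divisibility using (_∣_)
open import Data.Fin using (Fin; _<_)
open import Data.Fin.Properties using (<⇒≢)
open import Data.Vec using (Vec)
open import Function using (_∘_)
open import Relation.Binary.PropositionalEquality using (_≡_; _≢_; trans; refl; module ≡-Reasoning)
open MatchingsAndAlternatingPaths

lemma3p2 : ∀ {N n : ℕ} (G : Graph N) (a : Fin n → Fin N) →
    (∀ k l → a k ≡ a l → k ≡ l) →
    2 ∣ n →
    (isK : Fin n → Bool) →
    (mH : Vec (Fin N) N) →
    isPM G (VH a isK) mH ≡ true →
    (∀ m → isPM G (VH a isK) m ≡ true → m ≡ mH) →
    (i j : Fin n) → i < j →
    numAltPaths G a isK mH i j ≡ M G (VHij a isK i j)
lemma3p2 {N} G a a-injective _ isK mH mH-perfect mH-unique i j i<j = begin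
  numAltPaths G a isK mH i j               ≡⟨ countᵇ-cong same-paths (allListsUpTo N) ⟩
  countᵇ alternatingPath (allListsUpTo N)  ≡⟨ count-alternatingPaths mH-unique ⟩
  M G (VHij a isK i j)                     ∎
  where
  open ≡-Reasoning
  open Terminals a a-injective isK
  ai≢aj : a i ≢ a j
  ai≢aj = <⇒≢ i<j ∘ a-injective i j
  open AlternatingPaths G (VH a isK) mH (isPM⇒IsPerfectMatching G (VH a isK) mH mH-perfect)
         (a i) (a j) ai≢aj (VHij a isK i j)
         (trans (VHij-at-i ai≢aj) (isK≡not-VH i)) (trans (VHij-at-j ai≢aj) (isK≡not-VH j))
         (VHij-inner ai≢aj)
  same-paths : ∀ P → isAltPath G a isK mH i j P ≡ alternatingPath P
  same-paths P rewrite isK≡not-VH i | isK≡not-VH j = refl
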